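{- Let $k\ge 0$ be an integer and let $G$ be a triangle-free graph. Then $G$ contains no $k$-dense set of order $i$ for any $i\ge 2k+3$. Moreover, this bound is best possible: a triangle-free graph on $2k+2$ vertices whose whole vertex set is $k$-dense exists, and every such graph is isomorphic to the complete bipartite graph $K_{k+1,k+1}$.
   Context: All graphs are finite and simple. For a graph $G$ and a nonnegative integer $k$, a set $S$ of vertices is $k$-sparse if the induced subgraph $G[S]$ has maximum degree at most $k$; $S$ is $k$-dense if it is $k$-sparse in the complement of $G$, i.e. every vertex of $S$ is non-adjacent to at most $k$ other vertices of $S$. A graph is called $k$-dense if its whole vertex set is $k$-dense. A triangle-free graph is one containing no $K_3$. -}

module Defs where

open import Data.Nat using (ℕ; zero; suc; _+_; _≤_; _<ᵇ_)
open import Data.Bool using (Bool; true; false; _xor_; _∧_; not; if_then_else_)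
open import Data.Fin using (Fin; toℕ; _≟_)
open import Data.Fin.Subset using (Subset; _∈_; ⊤; ∣_∣)
open import Data.Vec using (lookup)
open import Data.List using (List; filter; length; allFin)
open import Data.Product using (_×_; Σ)
open import Relation.Nullary using (¬_; Dec; yes; no; _×-dec_; ¬?)
open import Relation.Nullary.Decidable using (Dec; does)
open import Relation.Binary.PropositionalEquality using (_≡_; _≢_)
open import Data.Bool.Properties using () renaming (_≟_ to _≟ᵇ_)
open import Function.Bundles using (_⤖_; Bijection)

record Graph (n : ℕ) : Set where
  field
    adj    : Fin n → Fin n → Bool
    sym    : ∀ u v → adj u v ≡ adj v u
    irrefl : ∀ v → adj v v ≡ false
open Graph public

TriangleFree : ∀ {n} → Graph n → Set
TriangleFree G = ∀ a b c → ¬ (adj G a b ≡ true × adj G b c ≡ true × adj G a c ≡ true)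

nonNeighboursIn : ∀ {n} → Graph n → Subset n → Fin n → List (Fin n)
nonNeighboursIn {n} G S v =
  filter (λ u → (lookup S u ≟ᵇ true) ×-dec (¬? (u ≟ v)) ×-dec (adj G v u ≟ᵇ false))
         (allFin n)

KDense : ∀ {n} → Graph n → ℕ → Subset n → Set
KDense {n} G k S = ∀ v → v ∈ S → length (nonNeighboursIn G S v) ≤ k

KDenseGraph : ∀ {n} → Graph n → ℕ → Set
KDenseGraph {n} G k = KDense G k ⊤

_≅_ : ∀ {n m} → Graph n → Graph m → Set
_≅_ {n} {m} G H =
  Σ (Fin n ⤖ Fin m) λ f →
    ∀ u v → adj G u v ≡ adj H (Bijection.to f u) (Bijection.to f v)

-- Complete bipartite graph K_{a,b} on Fin (a + b): parts {i < a} and {i ≥ a}.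
side : ∀ {n} → ℕ → Fin n → Bool
side a i = toℕ i <ᵇ a

KBip : (a b : ℕ) → Graph (a + b)
KBip a b = record
  { adj = λ u v → side a u xor side a v
  ; sym = λ u v → xor-comm (side a u) (side a v)
  ; irrefl = λ v → xor-self (side a v)
  }
  where
  xor-comm : ∀ x y → x xor y ≡ y xor x
  xor-comm false false = _≡_.refl
  xor-comm false true = _≡_.refl
  xor-comm true false = _≡_.refl
  xor-comm true true = _≡_.refl
  xor-self : ∀ x → x xor x ≡ false
  xor-self false = _≡_.refl
  xor-self true = _≡_.refl

module Submission where

-- A vertex v of a k-dense set S misses at most k vertices of S - v, so it has at least
-- |S| - 1 - k neighbours in S. In a triangle-free graph these neighbours are pairwise
-- non-adjacent, so one of them, u, misses all the others; hence v has at most k + 1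
-- neighbours in S and |S| ≤ 2k + 2. If G itself is k-dense on 2k + 2 vertices, every vertex
-- thus has degree exactly k + 1. For a neighbour u of a fixed vertex x, the neighbourhood
-- N(u) lies in the complement of N(x), which also has k + 1 vertices; so N(u) is that
-- complement, and G is complete bipartite with parts N(x) and its complement. Conversely,
-- in K_{k+1,k+1} each vertex misses exactly the k other vertices of its own side.

open import Defs hiding (sym)
open import Data.Bool using (Bool; true; false; _∧_; not; _xor_; if_then_else_)
open import Data.Bool.Properties
  using (not-involutive; xor-comm; xor-same; ∧-identityʳ) renaming (_≟_ to _≟ᵇ_)
open import Data.Fin using (Fin; zero; suc; toℕ; fromℕ<; punchOut; _≟_; _<_; _<?_)
open import Data.Fin.Properties
  using (any?; injective⇒≤; punchOut-injective; toℕ-fromℕ<; <-cmp; <-trans; <-irrefl)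
open import Data.Fin.Subset using (Subset; ∣_∣; ⊤)
open import Data.List using (length; filter; tabulate)
open import Data.Nat using (ℕ; zero; suc; _+_; _≤_; z≤n; s≤s; _<ᵇ_)
import Data.Nat as ℕ
import Data.Nat.Properties as ℕ
open import Data.Product using (_×_; Σ; ∃; _,_; proj₁)
open import Data.Vec using (lookup; _∷_; [])
open import Data.Vec.Properties using (lookup⇒[]=; lookup-replicate)
open import Function using (_∘_)
open import Function.Bundles using (_⤖_; Bijection; mk⤖)
open import Function.Consequences.Propositional using (strictlySurjective⇒surjective)
open import Function.Definitions using (Injective; Surjective; StrictlySurjective)
open import Relation.Binary using (tri<; tri≈; tri>)
open import Relation.Binary.PropositionalEquality
  using (_≡_; _≢_; refl; sym; trans; cong; cong₂; subst; module ≡-Reasoning)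
open import Relation.Nullary using (Dec; ¬_; does; yes; no; contradiction; _×-dec_; ¬?)
open import Relation.Nullary.Decidable using (dec-true; dec-false)
open import Relation.Unary using (Pred; Decidable)

private
  variable
    n a b k : ℕ

_∩_ : (p q : Fin n → Bool) → Fin n → Bool
(p ∩ q) i = p i ∧ q i

∁ : (Fin n → Bool) → Fin n → Bool
∁ p i = not (p i)

_-_ : (Fin n → Bool) → Fin n → Fin n → Bool
(p - v) i = p i ∧ not (does (i ≟ v))

_⊆_ : (p q : Fin n → Bool) → Set
p ⊆ q = ∀ i → p i ≡ true → q i ≡ true

∧-true⁻ : ∀ x {y} → x ∧ y ≡ true → x ≡ true × y ≡ true
∧-true⁻ true eq = refl , eq

∧-true : ∀ {x y} → x ≡ true → y ≡ true → x ∧ y ≡ true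
∧-true refl refl = refl

not-false : ∀ {x} → x ≡ false → not x ≡ true
not-false refl = refl

does-true⁻ : ∀ {A : Set} (a? : Dec A) → does a? ≡ true → A
does-true⁻ (yes a) _ = a

p∩q⊆p : (p q : Fin n → Bool) → (p ∩ q) ⊆ p
p∩q⊆p p q i = proj₁ ∘ ∧-true⁻ (p i)

∩-monoʳ : (p : Fin n → Bool) {q r : Fin n → Bool} → q ⊆ r → (p ∩ q) ⊆ (p ∩ r)
∩-monoʳ p q⊆r i with p i
... | true  = q⊆r i
... | false = λ ()

p⊆q⇒p-v⊆q-v : {p q : Fin n → Bool} {v : Fin n} → p ⊆ q → (p - v) ⊆ (q - v)
p⊆q⇒p-v⊆q-v {p = p} {v = v} p⊆q i with p i in pi | does (i ≟ v)
... | true  | false = λ _ → ∧-true (p⊆q i pi) refl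
... | true  | true  = λ ()
... | false | _     = λ ()

x∈p∧x≢v⇒x∈p-v : ∀ {p : Fin n → Bool} {u v} → p u ≡ true → u ≢ v → (p - v) u ≡ true
x∈p∧x≢v⇒x∈p-v {u = u} {v} pu u≢v = ∧-true pu (not-false (dec-false (u ≟ v) u≢v))

count : (Fin n → Bool) → ℕ
count {zero}  p = 0
count {suc n} p = if p zero then suc (count (p ∘ suc)) else count (p ∘ suc)

count-cong : {p q : Fin n → Bool} → (∀ i → p i ≡ q i) → count p ≡ count q
count-cong {zero}  eq = refl
count-cong {suc n} {p} {q} eq rewrite eq zero with q zero
... | true  = cong suc (count-cong (eq ∘ suc))
... | false = count-cong (eq ∘ suc)

count-mono : {p q : Fin n → Bool} → p ⊆ q → count p ≤ count q
count-mono {zero} p⊆q = z≤n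
count-mono {suc n} {p} {q} p⊆q with p zero in p₀ | q zero in q₀
... | true  | true  = s≤s (count-mono (p⊆q ∘ suc))
... | false | true  = ℕ.m≤n⇒m≤1+n (count-mono (p⊆q ∘ suc))
... | false | false = count-mono (p⊆q ∘ suc)
... | true  | false with () ← trans (sym (p⊆q zero p₀)) q₀

count-split : (p q : Fin n → Bool) → count p ≡ count (p ∩ q) + count (p ∩ ∁ q)
count-split {zero}  p q = refl
count-split {suc n} p q with p zero | q zero
... | true  | true  = cong suc (count-split (p ∘ suc) (q ∘ suc))
... | true  | false = trans (cong suc (count-split (p ∘ suc) (q ∘ suc)))
                           (sym (ℕ.+-suc _ _))
... | false | _     = count-split (p ∘ suc) (q ∘ suc)

count-remove : (p : Fin n → Bool) {v : Fin n} → p v ≡ true → count p ≡ suc (count (p - v))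
count-remove {suc n} p {zero} p₀ rewrite p₀ =
  cong suc (count-cong λ i → sym (∧-identityʳ (p (suc i))))
count-remove {suc n} p {suc v} pv with p zero
... | true  = cong suc (count-remove (p ∘ suc) pv)
... | false = count-remove (p ∘ suc) pv

count-witness : (p : Fin n → Bool) → 0 ℕ.< count p → ∃ λ i → p i ≡ true
count-witness {suc n} p pos with p zero in p₀
... | true  = zero , p₀
... | false with i , pi ← count-witness (p ∘ suc) pos = suc i , pi

count-strictMono : {p q : Fin n → Bool} {w : Fin n} →
  p ⊆ q → q w ≡ true → p w ≡ false → count p ℕ.< count q
count-strictMono {p = p} {q} {w} p⊆q qw pw = begin-strict
  count p        ≤⟨ count-mono p⊆q-w ⟩
  count (q - w)  <⟨ ℕ.n<1+n _ ⟩
  suc (count (q - w)) ≡⟨ sym (count-remove q qw) ⟩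
  count q        ∎
  where
  open ℕ.≤-Reasoning
  p⊆q-w : p ⊆ (q - w)
  p⊆q-w i pi = x∈p∧x≢v⇒x∈p-v {p = q} (p⊆q i pi) λ { refl → contradiction (trans (sym pi) pw) λ () }

count-true : count {n} (λ _ → true) ≡ n
count-true {zero}  = refl
count-true {suc n} = cong suc count-true

count+count∁ : (p : Fin n → Bool) → count p + count (∁ p) ≡ n
count+count∁ p = trans (sym (count-split (λ _ → true) p)) count-true

count-side : a ≤ n → count {n} (side a) ≡ a
count-side {zero}  {n}     _         = count-false {n}
  where
  count-false : ∀ {n} → count {n} (λ _ → false) ≡ 0
  count-false {zero}  = refl
  count-false {suc n} = count-false {n}
count-side {suc a} {suc n} (s≤s a≤n) = cong suc (count-side a≤n)

count∁ : (p : Fin n → Bool) → count p ≡ a → a + b ≡ n → count (∁ p) ≡ b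
count∁ {a = a} p refl a+b≡n = ℕ.+-cancelˡ-≡ a _ _ (trans (count+count∁ p) (sym a+b≡n))

degreeIn : Graph n → (Fin n → Bool) → Fin n → ℕ
degreeIn G s v = count (s ∩ adj G v)

nonNeighbours : Graph n → (Fin n → Bool) → Fin n → Fin n → Bool
nonNeighbours G s v = (s ∩ ∁ (adj G v)) - v

KDenseᵇ : Graph n → ℕ → (Fin n → Bool) → Set
KDenseᵇ G k s = ∀ v → s v ≡ true → count (nonNeighbours G s v) ≤ k

length-filter-tabulate : ∀ {ℓ} {A : Set} {P : Pred A ℓ} (P? : Decidable P) (f : Fin n → A) →
  length (filter P? (tabulate f)) ≡ count (λ i → does (P? (f i)))
length-filter-tabulate {zero}  P? f = refl
length-filter-tabulate {suc n} P? f with does (P? (f zero))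
... | true  = cong suc (length-filter-tabulate P? (f ∘ suc))
... | false = length-filter-tabulate P? (f ∘ suc)

length-nonNeighboursIn : (G : Graph n) (S : Subset n) (v : Fin n) →
  length (nonNeighboursIn G S v) ≡ count (nonNeighbours G (lookup S) v)
length-nonNeighboursIn G S v =
  trans (length-filter-tabulate nonNeighbour? (λ u → u)) (count-cong reorder)
  where
  nonNeighbour? = λ u → (lookup S u ≟ᵇ true) ×-dec ¬? (u ≟ v) ×-dec (adj G v u ≟ᵇ false)
  reorder : ∀ u → does (lookup S u ≟ᵇ true) ∧ (not (does (u ≟ v)) ∧ does (adj G v u ≟ᵇ false))
                  ≡ nonNeighbours G (lookup S) v u
  reorder u with lookup S u | adj G v u | does (u ≟ v)
  ... | true  | true  | true  = refl
  ... | true  | true  | false = refl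
  ... | true  | false | true  = refl
  ... | true  | false | false = refl
  ... | false | _     | _     = refl

length-nonNeighboursIn-⊤ : (G : Graph n) (v : Fin n) →
  length (nonNeighboursIn G ⊤ v) ≡ count (nonNeighbours G (λ _ → true) v)
length-nonNeighboursIn-⊤ G v = trans (length-nonNeighboursIn G ⊤ v) (count-cong λ u →
  cong (λ x → (x ∧ not (adj G v u)) ∧ not (does (u ≟ v))) (lookup-replicate u true))

KDense⇒KDenseᵇ : (G : Graph n) (S : Subset n) → KDense G k S → KDenseᵇ G k (lookup S)
KDense⇒KDenseᵇ {k = k} G S dense v Sv =
  subst (_≤ k) (length-nonNeighboursIn G S v) (dense v (lookup⇒[]= v S Sv))

KDenseGraph⇒KDenseᵇ : (G : Graph n) → KDenseGraph G k → KDenseᵇ G k (λ _ → true)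
KDenseGraph⇒KDenseᵇ {k = k} G dense v _ =
  subst (_≤ k) (length-nonNeighboursIn-⊤ G v) (dense v (lookup⇒[]= v ⊤ (lookup-replicate v true)))

KDenseᵇ⇒KDenseGraph : (G : Graph n) → KDenseᵇ G k (λ _ → true) → KDenseGraph G k
KDenseᵇ⇒KDenseGraph {k = k} G dense v _ =
  subst (_≤ k) (sym (length-nonNeighboursIn-⊤ G v)) (dense v refl)

count≡degreeIn+1+nonNeighbours : (G : Graph n) (s : Fin n → Bool) {v : Fin n} → s v ≡ true →
  count s ≡ degreeIn G s v + suc (count (nonNeighbours G s v))
count≡degreeIn+1+nonNeighbours G s {v} sv = begin
  count s                                             ≡⟨ count-split s (adj G v) ⟩
  degreeIn G s v + count (s ∩ ∁ (adj G v))            ≡⟨ cong (degreeIn G s v +_)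
                                                           (count-remove (s ∩ ∁ (adj G v)) v∉N[v]) ⟩
  degreeIn G s v + suc (count (nonNeighbours G s v))  ∎
  where
  open ≡-Reasoning
  v∉N[v] : (s ∩ ∁ (adj G v)) v ≡ true
  v∉N[v] = ∧-true sv (not-false (irrefl G v))

neighbours-nonadjacent : (G : Graph n) → TriangleFree G → {u v w : Fin n} →
  adj G v u ≡ true → adj G v w ≡ true → adj G u w ≡ false
neighbours-nonadjacent G tf {u} {v} {w} vu vw with adj G u w in uw
... | false = refl
... | true  = contradiction (vu , uw , vw) (tf v u w)

degreeIn≤1+nonNeighbours : (G : Graph n) → TriangleFree G → (s : Fin n → Bool) {u v : Fin n} →
  s u ≡ true → adj G v u ≡ true → degreeIn G s v ≤ suc (count (nonNeighbours G s u))
degreeIn≤1+nonNeighbours G tf s {u} {v} su vu = begin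
  degreeIn G s v                       ≡⟨ count-remove (s ∩ adj G v) (∧-true su vu) ⟩
  suc (count ((s ∩ adj G v) - u))      ≤⟨ s≤s (count-mono N[v]-u⊆nonN[u]) ⟩
  suc (count (nonNeighbours G s u))    ∎
  where
  open ℕ.≤-Reasoning
  N[v]-u⊆nonN[u] : ((s ∩ adj G v) - u) ⊆ nonNeighbours G s u
  N[v]-u⊆nonN[u] = p⊆q⇒p-v⊆q-v {p = s ∩ adj G v} (∩-monoʳ s {adj G v} λ w vw →
    not-false (neighbours-nonadjacent G tf vu vw))

degreeIn-lower : (G : Graph n) {s : Fin n → Bool} → KDenseᵇ G k s → {v : Fin n} → s v ≡ true →
  count s ≤ suc (degreeIn G s v + k)
degreeIn-lower {k = k} G {s} dense {v} sv = begin
  count s                                             ≡⟨ count≡degreeIn+1+nonNeighbours G s sv ⟩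
  degreeIn G s v + suc (count (nonNeighbours G s v))  ≡⟨ ℕ.+-suc _ _ ⟩
  suc (degreeIn G s v + count (nonNeighbours G s v))  ≤⟨ s≤s (ℕ.+-monoʳ-≤ (degreeIn G s v) (dense v sv)) ⟩
  suc (degreeIn G s v + k)                            ∎
  where open ℕ.≤-Reasoning

degreeIn-upper : (G : Graph n) {s : Fin n → Bool} → TriangleFree G → KDenseᵇ G k s →
  (v : Fin n) → degreeIn G s v ≤ suc k
degreeIn-upper {k = k} G {s} tf dense v with count (s ∩ adj G v) in d
... | zero  = z≤n
... | suc _ with u , su∧vu ← count-witness (s ∩ adj G v) (subst (0 ℕ.<_) (sym d) (s≤s z≤n))
            with su , vu ← ∧-true⁻ (s u) su∧vu =
  subst (_≤ suc k) d (ℕ.≤-trans (degreeIn≤1+nonNeighbours G tf s su vu) (s≤s (dense u su)))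

KDenseᵇ⇒count≤2+k+k : (G : Graph n) {s : Fin n → Bool} → TriangleFree G → KDenseᵇ G k s →
  count s ≤ suc (suc (k + k))
KDenseᵇ⇒count≤2+k+k {k = k} G {s} tf dense with count s in c
... | zero  = z≤n
... | suc _ with v , sv ← count-witness s (subst (0 ℕ.<_) (sym c) (s≤s z≤n)) = begin
  suc _                      ≡⟨ sym c ⟩
  count s                    ≤⟨ degreeIn-lower G dense sv ⟩
  suc (degreeIn G s v + k)   ≤⟨ s≤s (ℕ.+-monoˡ-≤ k (degreeIn-upper G tf dense v)) ⟩
  suc (suc k + k)            ∎
  where open ℕ.≤-Reasoning

∣S∣≡count : (S : Subset n) → ∣ S ∣ ≡ count (lookup S)
∣S∣≡count []          = refl
∣S∣≡count (true  ∷ S) = cong suc (∣S∣≡count S)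
∣S∣≡count (false ∷ S) = ∣S∣≡count S

noLargeKDenseSet : (G : Graph n) → TriangleFree G → {i : ℕ} → suc (suc (suc (k + k))) ≤ i →
  ¬ (Σ (Subset n) λ S → ∣ S ∣ ≡ i × KDense G k S)
noLargeKDenseSet {k = k} G tf {i} large (S , ∣S∣≡i , dense) = ℕ.<⇒≱ large (begin
  i                    ≡⟨ sym ∣S∣≡i ⟩
  ∣ S ∣                ≡⟨ ∣S∣≡count S ⟩
  count (lookup S)     ≤⟨ KDenseᵇ⇒count≤2+k+k G tf (KDense⇒KDenseᵇ G S dense) ⟩
  suc (suc (k + k))    ∎)
  where open ℕ.≤-Reasoning

degree≡1+k : (G : Graph n) → TriangleFree G → KDenseᵇ G k (λ _ → true) → suc k + suc k ≡ n →
  (v : Fin n) → count (adj G v) ≡ suc k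
degree≡1+k {n} {k} G tf dense 2[1+k]≡n v =
  ℕ.≤-antisym (degreeIn-upper G tf dense v) (ℕ.+-cancelʳ-≤ k _ _ (ℕ.≤-pred (begin
    suc (suc k + k)            ≡⟨ sym (ℕ.+-suc (suc k) k) ⟩
    suc k + suc k              ≡⟨ trans 2[1+k]≡n (sym (count-true {n})) ⟩
    count {n} (λ _ → true)     ≤⟨ degreeIn-lower G dense refl ⟩
    suc (count (adj G v) + k)  ∎)))
  where open ℕ.≤-Reasoning

module _ (G : Graph n) (tf : TriangleFree G) {d : ℕ} (regular : ∀ v → count (adj G v) ≡ d)
         (d+d≡n : d + d ≡ n) (x : Fin n) where

  private
    across : ∀ {u w} → adj G x u ≡ true → adj G x w ≡ false → adj G u w ≡ true
    across {u} {w} xu xw with adj G u w in uw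
    ... | true  = refl
    ... | false = contradiction (count-strictMono N[u]⊆∁N[x] (not-false xw) uw) λ d<d →
      ℕ.<-irrefl (trans (regular u) (sym (count∁ (adj G x) (regular x) d+d≡n))) d<d
      where
      N[u]⊆∁N[x] : adj G u ⊆ ∁ (adj G x)
      N[u]⊆∁N[x] y uy = not-false (neighbours-nonadjacent G tf (trans (Graph.sym G u x) xu) uy)

    degree-pos : ∀ {u w} → adj G u w ≡ true → 0 ℕ.< d
    degree-pos {u} uw = subst (0 ℕ.<_) (trans (sym (count-remove (adj G u) uw)) (regular u)) (s≤s z≤n)

  regular-triangleFree⇒bipartite : (u w : Fin n) → adj G u w ≡ adj G x u xor adj G x w
  regular-triangleFree⇒bipartite u w with adj G x u in xu | adj G x w in xw
  ... | true  | true  = neighbours-nonadjacent G tf xu xw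
  ... | true  | false = across xu xw
  ... | false | true  = trans (Graph.sym G u w) (across xw xu)
  ... | false | false with adj G u w in uw
  ...   | false = refl
  ...   | true
    with y , xy ← count-witness (adj G x) (subst (0 ℕ.<_) (sym (regular x)) (degree-pos uw)) =
    contradiction (across xy xu , uw , across xy xw) (tf y u w)

injective⇒strictlySurjective : ∀ {n m} {f : Fin n → Fin m} → m ≤ n → Injective _≡_ _≡_ f →
  StrictlySurjective _≡_ f
injective⇒strictlySurjective {n} {suc m} {f} m<n f-injective y with any? (λ x → f x ≟ y)
... | yes hit  = hit
... | no  miss = contradiction (injective⇒≤ g-injective) (ℕ.<⇒≱ m<n)
  where
  y≢f : ∀ x → y ≢ f x
  y≢f x y≡fx = miss (x , sym y≡fx)
  g : Fin n → Fin m
  g x = punchOut (y≢f x)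
  g-injective : Injective _≡_ _≡_ g
  g-injective eq = f-injective (punchOut-injective (y≢f _) (y≢f _) eq)

below : Fin n → Fin n → Bool
below u i = does (i <? u)

rank : (Fin n → Bool) → Fin n → ℕ
rank p u = count (p ∩ below u)

below-irrefl : (u : Fin n) → below u u ≡ false
below-irrefl u = dec-false (u <? u) (<-irrefl refl)

rank<count : (p : Fin n → Bool) {u : Fin n} → p u ≡ true → rank p u ℕ.< count p
rank<count p {u} pu = count-strictMono (p∩q⊆p p (below u)) pu (cong₂ _∧_ pu (below-irrefl u))

rank-strictMono : (p : Fin n → Bool) {u w : Fin n} → p u ≡ true → u < w → rank p u ℕ.< rank p w
rank-strictMono p {u} {w} pu u<w =
  count-strictMono (∩-monoʳ p below-mono) (∧-true pu (dec-true (u <? w) u<w))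
                   (cong₂ _∧_ pu (below-irrefl u))
  where
  below-mono : below u ⊆ below w
  below-mono i i<u = dec-true (i <? w) (<-trans (does-true⁻ (i <? u) i<u) u<w)

rank-injective : (p : Fin n → Bool) {u w : Fin n} → p u ≡ true → p w ≡ true →
  rank p u ≡ rank p w → u ≡ w
rank-injective p {u} {w} pu pw eq with <-cmp u w
... | tri< u<w _ _ = contradiction eq (ℕ.<⇒≢ (rank-strictMono p pu u<w))
... | tri≈ _ u≡w _ = u≡w
... | tri> _ _ w<u = contradiction (sym eq) (ℕ.<⇒≢ (rank-strictMono p pw w<u))

partitionIndex : (Fin n → Bool) → Fin n → ℕ
partitionIndex p u = if p u then rank p u else count p + rank (∁ p) u

partitionIndex< : (p : Fin n → Bool) (u : Fin n) → partitionIndex p u ℕ.< count p + count (∁ p)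
partitionIndex< p u with p u in pu
... | true  = ℕ.<-≤-trans (rank<count p pu) (ℕ.m≤m+n (count p) _)
... | false = ℕ.+-monoʳ-< (count p) (rank<count (∁ p) (not-false pu))

partitionIndex-side : (p : Fin n → Bool) (u : Fin n) → (partitionIndex p u <ᵇ count p) ≡ p u
partitionIndex-side p u with p u in pu
... | true  = dec-true (_ ℕ.<? count p) (rank<count p pu)
... | false = dec-false (_ ℕ.<? count p) (ℕ.m+n≮m (count p) _)

partitionIndex-sameSide : (p : Fin n → Bool) {u w : Fin n} →
  partitionIndex p u ≡ partitionIndex p w → p u ≡ p w
partitionIndex-sameSide p {u} {w} eq = trans (sym (partitionIndex-side p u))
  (trans (cong (_<ᵇ count p) eq) (partitionIndex-side p w))

partitionIndex-injective : (p : Fin n → Bool) {u w : Fin n} →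
  partitionIndex p u ≡ partitionIndex p w → u ≡ w
partitionIndex-injective p {u} {w} eq = bySide (partitionIndex-sameSide p eq) eq
  where
  bySide : p u ≡ p w → partitionIndex p u ≡ partitionIndex p w → u ≡ w
  bySide pu≡pw eq with p u in pu | p w in pw
  bySide refl eq | true  | true  = rank-injective p pu pw eq
  bySide refl eq | false | false =
    rank-injective (∁ p) (not-false pu) (not-false pw) (ℕ.+-cancelˡ-≡ (count p) _ _ eq)

partitionBijection : (p : Fin n → Bool) → count p ≡ a → count (∁ p) ≡ b →
  Σ (Fin n ⤖ Fin (a + b)) λ f → ∀ u → side a (Bijection.to f u) ≡ p u
partitionBijection p refl refl = mk⤖ (f-injective , f-surjective) , f-side
  where
  f : Fin _ → Fin (count p + count (∁ p))
  f u = fromℕ< (partitionIndex< p u)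
  toℕ-f : ∀ u → toℕ (f u) ≡ partitionIndex p u
  toℕ-f u = toℕ-fromℕ< (partitionIndex< p u)
  f-injective : Injective _≡_ _≡_ f
  f-injective {u} {w} eq =
    partitionIndex-injective p (trans (sym (toℕ-f u)) (trans (cong toℕ eq) (toℕ-f w)))
  f-surjective : Surjective _≡_ _≡_ f
  f-surjective = strictlySurjective⇒surjective
    (injective⇒strictlySurjective (ℕ.≤-reflexive (count+count∁ p)) f-injective)
  f-side : ∀ u → side (count p) (f u) ≡ p u
  f-side u = trans (cong (_<ᵇ count p) (toℕ-f u)) (partitionIndex-side p u)

bipartition⇒≅KBip : (G : Graph n) (p : Fin n → Bool) → (∀ u w → adj G u w ≡ p u xor p w) →
  count p ≡ a → count (∁ p) ≡ b → G ≅ KBip a b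
bipartition⇒≅KBip G p adj≡xor |p|≡a |∁p|≡b with f , f-side ← partitionBijection p |p|≡a |∁p|≡b =
  f , λ u w → trans (adj≡xor u w) (cong₂ _xor_ (sym (f-side u)) (sym (f-side w)))

completeBipartite : (Fin n → Bool) → Graph n
completeBipartite c = record
  { adj    = λ u v → c u xor c v
  ; sym    = λ u v → xor-comm (c u) (c v)
  ; irrefl = λ v → xor-same (c v)
  }

xor-noTriangle : ∀ x y z → x xor y ≡ true → y xor z ≡ true → x xor z ≡ false
xor-noTriangle true  false true  _  _  = refl
xor-noTriangle false true  false _  _  = refl
xor-noTriangle true  true  _     () _
xor-noTriangle false false _     () _
xor-noTriangle true  false false _  ()
xor-noTriangle false true  true  _  ()

completeBipartite-triangleFree : (c : Fin n → Bool) → TriangleFree (completeBipartite c)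
completeBipartite-triangleFree c u v w (uv , vw , uw) with () ←
  trans (sym uw) (xor-noTriangle (c u) (c v) (c w) uv vw)

completeBipartite-KDenseᵇ : (c : Fin n → Bool) → count c ≤ suc k → count (∁ c) ≤ suc k →
  KDenseᵇ (completeBipartite c) k (λ _ → true)
completeBipartite-KDenseᵇ {k = k} c |c|≤ |∁c|≤ v _ = ℕ.≤-pred (begin
  suc (count (sameSide - v))   ≡⟨ sym (count-remove sameSide (not-false (xor-same (c v)))) ⟩
  count sameSide               ≤⟨ count-sameSide ⟩
  suc k                        ∎)
  where
  open ℕ.≤-Reasoning
  sameSide : Fin _ → Bool
  sameSide u = not (c v xor c u)
  count-sameSide : count sameSide ≤ suc k
  count-sameSide with c v
  ... | true  = subst (_≤ suc k) (count-cong λ u → sym (not-involutive (c u))) |c|≤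
  ... | false = |∁c|≤

proposition2p1 : (k : ℕ) →
    ((n : ℕ) (G : Graph n) → TriangleFree G →
    (i : ℕ) → suc (suc (suc (k + k))) ≤ i →
    ¬ (Σ (Subset n) λ S → ∣ S ∣ ≡ i × KDense G k S))
    × (Σ (Graph (suc (suc (k + k)))) λ G → TriangleFree G × KDenseGraph G k)
    × ((G : Graph (suc (suc (k + k)))) → TriangleFree G → KDenseGraph G k →
    G ≅ KBip (suc k) (suc k))
proposition2p1 k =
    (λ n G tf i → noLargeKDenseSet G tf)
  , (Kₖ₊₁,ₖ₊₁ , completeBipartite-triangleFree halves
    , KDenseᵇ⇒KDenseGraph Kₖ₊₁,ₖ₊₁ (completeBipartite-KDenseᵇ halves
        (ℕ.≤-reflexive |halves|) (ℕ.≤-reflexive (count∁ halves |halves| 2[1+k]))))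
  , λ G tf dense →
      let regular = degree≡1+k G tf (KDenseGraph⇒KDenseᵇ G dense) 2[1+k] in
      bipartition⇒≅KBip G (adj G zero) (regular-triangleFree⇒bipartite G tf regular 2[1+k] zero)
        (regular zero) (count∁ (adj G zero) (regular zero) 2[1+k])
  where
  2[1+k] : suc k + suc k ≡ suc (suc (k + k))
  2[1+k] = cong suc (ℕ.+-suc k k)
  halves : Fin (suc (suc (k + k))) → Bool
  halves = side (suc k)
  |halves| : count halves ≡ suc k
  |halves| = count-side (s≤s (ℕ.≤-trans (ℕ.m≤m+n k k) (ℕ.n≤1+n _)))
  Kₖ₊₁,ₖ₊₁ : Graph (suc (suc (k + k)))
  Kₖ₊₁,ₖ₊₁ = completeBipartite halves
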